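{- Fix positive integers $r,s$. Let $\sigma_0\in\mathbf{Rec}$ be any state and set $\sigma_t=(x(t),y(t),z(t))=f_{r,s}(\sigma_{t-1})$ for $t\ge1$. Then $|x(t)\sqrt{s}+y(t)\sqrt{r}|$ is bounded independently of $t$. Specifically, for every $\epsilon>0$ there exists $N\in\mathbb{N}$ such that for all $t>N$, $$-\frac{(r-2)\sqrt{s}+s\sqrt{r}+\epsilon}{2}<x(t)\sqrt{s}+y(t)\sqrt{r}<\frac{(r+2)\sqrt{s}+s\sqrt{r}+\epsilon}{2}.$$
   Context: Fix positive integers $r,s$. In the one-dimensional generalized rotor-router model, a particle starts at $0$, at each occupied site moves left if the label there is $L$ and right if it is $R$, then flips that label; on first reaching an unoccupied site to the left (resp. right) of the occupied interval, $r$ (resp. $s$) new consecutive sites on that side become occupied, labeled $R$; this defines the map $f_{r,s}$. The recurrent states $\mathbf{Rec}$ are identified with integer triples $(x,y,z)$, $x\le0\le y$, $x\le z\le y$ (the state with occupied interval $[x,y+s-1]$, labels $R$ on $[x,z-1]$, $L$ on $[z,y-1]$, $R$ on $[y,y+s-1]$); on them $f_{r,s}(x,y,z)=(x,y+s,z-y)$ if $x+y\le z$ and $f_{r,s}(x,y,z)=(x-r,y,z-x+1)$ if $x+y>z$.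
   Formalization: The parameter ε ranges only over the positive rational numbers. -}

module Defs where

open import Data.Nat using (ℕ; zero; suc)
open import Data.Integer as ℤ using (ℤ; +_; _-_; _≤?_)
open import Data.Product using (Σ; _×_; _,_; ∃)
open import Data.Sum using (_⊎_)
open import Relation.Nullary using (yes; no)
open import Data.Rational as ℚ using (ℚ; 0ℚ)

State : Set
State = ℤ × ℤ × ℤ

InRec : State → Set
InRec (x , y , z) = (x ℤ.≤ + 0) × (+ 0 ℤ.≤ y) × (x ℤ.≤ z) × (z ℤ.≤ y)

f : ℕ → ℕ → State → State
f r s (x , y , z) with (x ℤ.+ y) ≤? z
... | yes _ = (x , y ℤ.+ + s , z - y)
... | no  _ = (x - + r , y , (z - x) ℤ.+ + 1)

iter : (State → State) → ℕ → State → State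
iter g zero    σ = σ
iter g (suc t) σ = g (iter g t σ)

ι : ℤ → ℚ
ι z = z ℚ./ 1

-- The real number A·√m (A ∈ ℤ, m ∈ ℕ) represented by its lower Dedekind cut:
-- LeSqrt p A m  means  p ≤ A·√m  (for p ∈ ℚ).
LeSqrt : ℚ → ℤ → ℕ → Set
LeSqrt p A m =
  ((+ 0 ℤ.≤ A) × ((p ℚ.≤ 0ℚ) ⊎ (p ℚ.* p ℚ.≤ ι (A ℤ.* A ℤ.* + m))))
  ⊎ ((A ℤ.< + 0) × (p ℚ.≤ 0ℚ) × (ι (A ℤ.* A ℤ.* + m) ℚ.≤ p ℚ.* p))

-- PosComb r s A B c  means  A·√s + B·√r + c > 0  (real inequality), where
-- A, B ∈ ℤ, c ∈ ℚ: there are rationals p ≤ A√s, q ≤ B√r with p + q + c > 0.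
PosComb : ℕ → ℕ → ℤ → ℤ → ℚ → Set
PosComb r s A B c =
  Σ ℚ λ p → Σ ℚ λ q → LeSqrt p A s × LeSqrt q B r × (0ℚ ℚ.< p ℚ.+ q ℚ.+ c)

{-# OPTIONS --safe #-}
-- The quantity I(x,y,z) = r y (y - s) - s x (x + r - 2) + 2 r s z is conserved by f_{r,s}.
-- Since x ≤ z ≤ y on Rec, it pins s x² - r y² to within O(y - x) of a constant, and,
-- after completing squares, bounds s (2x+r-2)² - r (2y+s)² and r (s-2y)² - s (r+2-2x)²
-- from above by a constant. A difference of squares a P² - b Q² bounded in this way forces
-- P √a - Q √b = O(1), and even o(1) as P + Q grows; and y - x, hence P + Q, grows by at
-- least one at every step. The real inequalities are certified by rational lower bounds
-- on the square roots, read off from integer square roots of a P² M² and b Q² M².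
module Submission where

open import Defs
open import Data.Nat as ℕ using (ℕ; zero; suc; _<_)
import Data.Nat.Properties as ℕ
open import Data.Integer as ℤ using (ℤ; +_; -_; _-_; -[1+_]; _+_; _*_; _≤_; ∣_∣; 0ℤ; 1ℤ)
import Data.Integer.Properties as ℤ
open import Data.Integer.Tactic.RingSolver using (solve-∀)
open import Data.Rational as ℚ using (ℚ; 0ℚ; mkℚ; _/_; toℚᵘ)
import Data.Rational.Properties as ℚ
open import Data.Rational.Unnormalised as ℚᵘ using (mkℚᵘ; *≤*; *<*; *≡*; _≃_)
import Data.Rational.Unnormalised.Properties as ℚᵘ
open import Data.Product using (Σ; _×_; _,_)
open import Data.Sum using (inj₁; inj₂)
open import Relation.Binary.PropositionalEquality
open import Relation.Nullary using (yes; no)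
open import Relation.Nullary.Negation using (contradiction)

≤-of-difference : ∀ {i j} d → j - i ≡ d → 0ℤ ≤ d → i ≤ j
≤-of-difference d j-i≡d 0≤d = ℤ.0≤i-j⇒j≤i (subst (0ℤ ≤_) (sym j-i≡d) 0≤d)

*-nonNeg : ∀ {i j} → 0ℤ ≤ i → 0ℤ ≤ j → 0ℤ ≤ i * j
*-nonNeg 0≤i 0≤j = ℤ.*-monoʳ-≤-nonNeg _ {{ℤ.nonNegative 0≤j}} 0≤i

nonNeg-multiple : ∀ n {i} → 0ℤ ≤ i → 0ℤ ≤ + n * i
nonNeg-multiple n 0≤i = *-nonNeg {+ n} (ℤ.+≤+ ℕ.z≤n) 0≤i

square-nonNeg : ∀ i → 0ℤ ≤ i * i
square-nonNeg (+ n)    = subst (0ℤ ≤_) (ℤ.pos-* n n) (ℤ.+≤+ ℕ.z≤n)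
square-nonNeg -[1+ n ] = ℤ.+≤+ ℕ.z≤n

square-mono : ∀ {i j} → 0ℤ ≤ i → i ≤ j → i * i ≤ j * j
square-mono {i} {j} 0≤i i≤j =
  ℤ.≤-trans (ℤ.*-monoʳ-≤-nonNeg i {{ℤ.nonNegative 0≤i}} i≤j)
            (ℤ.*-monoˡ-≤-nonNeg j {{ℤ.nonNegative (ℤ.≤-trans 0≤i i≤j)}} i≤j)

i≤i*n : ∀ {i n} → 0ℤ ≤ i → 1 ℕ.≤ n → i ≤ i * + n
i≤i*n {+ k} {n} _ 1≤n = subst (+ k ≤_) (ℤ.pos-* k n) (ℤ.+≤+ (ℕ.m≤m*n k n {{ℕ.>-nonZero 1≤n}}))

0≤∣i∣+i : ∀ i → 0ℤ ≤ + ∣ i ∣ + i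
0≤∣i∣+i (+ n)    = ℤ.+≤+ ℕ.z≤n
0≤∣i∣+i -[1+ n ] = ℤ.≤-reflexive (sym (ℤ.+-inverseʳ (+ suc n)))

0≤∣i∣-i : ∀ i → 0ℤ ≤ + ∣ i ∣ - i
0≤∣i∣-i i = subst (λ n → 0ℤ ≤ + n - i) (ℤ.∣-i∣≡∣i∣ i) (0≤∣i∣+i (- i))

isqrt : ∀ n → Σ ℕ λ k → k ℕ.* k ℕ.≤ n × n ℕ.< suc k ℕ.* suc k
isqrt zero    = 0 , ℕ.z≤n , ℕ.s≤s ℕ.z≤n
isqrt (suc n) with isqrt n
... | k , k²≤n , n<[k+1]² with suc k ℕ.* suc k ℕ.≤? suc n
...   | yes [k+1]²≤1+n = suc k , [k+1]²≤1+n ,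
          ℕ.≤-<-trans n<[k+1]² (ℕ.*-mono-< (ℕ.n<1+n (suc k)) (ℕ.n<1+n (suc k)))
...   | no  [k+1]²≰1+n = k , ℕ.m≤n⇒m≤1+n k²≤n , ℕ.≰⇒> [k+1]²≰1+n

floor-sqrt : ∀ {X} → 0ℤ ≤ X → Σ ℕ λ k → + k * + k ≤ X × X ℤ.< + suc k * + suc k
floor-sqrt (ℤ.+≤+ {n = n} _) with isqrt n
... | k , k²≤n , n<[k+1]² = k , subst (_≤ + n) (ℤ.pos-* k k) (ℤ.+≤+ k²≤n)
                              , subst (+ n ℤ.<_) (ℤ.pos-* (suc k) (suc k)) (ℤ.+<+ n<[k+1]²)

≤-of-square-< : ∀ {u k} → u * u ℤ.< + suc k * + suc k → u ≤ + k
≤-of-square-< {u} {k} u²<[k+1]² with u ℤ.≤? + k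
... | yes u≤k = u≤k
... | no  u≰k = contradiction u²<[k+1]²
                  (ℤ.≤⇒≯ (square-mono (ℤ.+≤+ ℕ.z≤n) (ℤ.i<j⇒suc[i]≤j (ℤ.≰⇒> u≰k))))

scaled-square-nonNeg : ∀ A a M → 0ℤ ≤ A * A * + a * (M * M)
scaled-square-nonNeg A a M = *-nonNeg (*-nonNeg (square-nonNeg A) (ℤ.+≤+ ℕ.z≤n)) (square-nonNeg M)

≤-of-scaled-square-< : ∀ {u a k} → 1 ℕ.≤ a → u * u * + a ℤ.< + suc k * + suc k → u ≤ + k
≤-of-scaled-square-< {u} 1≤a u²a<[k+1]² =
  ≤-of-square-< (ℤ.≤-<-trans (i≤i*n (square-nonNeg u) 1≤a) u²a<[k+1]²)

-- If kB + j < kA then kA² - (kB+1)² = (kA - kB - 1)(kA + kB + 1) ≥ j (kA + kB + 1) ≥ E.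
floor-sqrt-gap : ∀ {X Y E kA kB j} → + kA * + kA ≤ X → Y ℤ.< + suc kB * + suc kB → X ≤ Y + E →
                 E ≤ + j * (+ kA + + kB + 1ℤ) → + kA ≤ + kB + + j
floor-sqrt-gap {X} {Y} {E} {kA} {kB} {j} kA²≤X Y<[kB+1]² X≤Y+E E≤jS with + kA ℤ.≤? + kB + + j
... | yes kA≤kB+j = kA≤kB+j
... | no  kA≰kB+j = contradiction (begin-strict
      + suc kB * + suc kB + + j * S  ≤⟨ ≤-of-difference (δ * S) (identity (+ kA) (+ kB) (+ j))
                                          (*-nonNeg 0≤δ (ℤ.+≤+ ℕ.z≤n)) ⟩
      + kA * + kA                    ≤⟨ kA²≤X ⟩
      X                              ≤⟨ X≤Y+E ⟩
      Y + E                          <⟨ ℤ.+-mono-<-≤ Y<[kB+1]² E≤jS ⟩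
      + suc kB * + suc kB + + j * S  ∎) (ℤ.<-irrefl refl)
  where
  open ℤ.≤-Reasoning
  S = + kA + + kB + 1ℤ
  δ = + kA - (1ℤ + (+ kB + + j))
  0≤δ : 0ℤ ≤ δ
  0≤δ = ℤ.i≤j⇒0≤j-i (ℤ.i<j⇒suc[i]≤j (ℤ.≰⇒> kA≰kB+j))
  identity : ∀ a b c →
    a * a - ((1ℤ + b) * (1ℤ + b) + c * (a + b + 1ℤ)) ≡ (a - (1ℤ + (b + c))) * (a + b + 1ℤ)
  identity = solve-∀

toℚᵘ-/ : ∀ i m → toℚᵘ (i / suc m) ≃ mkℚᵘ i m
toℚᵘ-/ i m = ℚ.toℚᵘ-fromℚᵘ (mkℚᵘ i m)

/-mono-≤ : ∀ {i j} m → i ≤ j → i / suc m ℚ.≤ j / suc m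
/-mono-≤ {i} {j} m i≤j = ℚ.toℚᵘ-cancel-≤ (begin
  toℚᵘ (i / suc m)  ≃⟨ toℚᵘ-/ i m ⟩
  mkℚᵘ i m          ≤⟨ *≤* (ℤ.*-monoʳ-≤-nonNeg (+ suc m) i≤j) ⟩
  mkℚᵘ j m          ≃⟨ toℚᵘ-/ j m ⟨
  toℚᵘ (j / suc m)  ∎)
  where open ℚᵘ.≤-Reasoning

/-mono-< : ∀ {i j} m → i ℤ.< j → i / suc m ℚ.< j / suc m
/-mono-< {i} {j} m i<j = ℚ.toℚᵘ-cancel-< (begin-strict
  toℚᵘ (i / suc m)  ≃⟨ toℚᵘ-/ i m ⟩
  mkℚᵘ i m          <⟨ *<* (ℤ.*-monoʳ-<-pos (+ suc m) i<j) ⟩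
  mkℚᵘ j m          ≃⟨ toℚᵘ-/ j m ⟨
  toℚᵘ (j / suc m)  ∎)
  where open ℚᵘ.≤-Reasoning

/-nonPos : ∀ {i} m → i ≤ 0ℤ → i / suc m ℚ.≤ 0ℚ
/-nonPos {i} m i≤0 = subst (i / suc m ℚ.≤_) (ℚ.0/n≡0 (suc m)) (/-mono-≤ m i≤0)

/-+ : ∀ i j m → i / suc m ℚ.+ j / suc m ≡ (i + j) / suc m
/-+ i j m = ℚ.toℚᵘ-injective (begin-equality
  toℚᵘ (i / suc m ℚ.+ j / suc m)           ≃⟨ ℚ.toℚᵘ-homo-+ (i / suc m) (j / suc m) ⟩
  toℚᵘ (i / suc m) ℚᵘ.+ toℚᵘ (j / suc m)   ≃⟨ ℚᵘ.+-cong (toℚᵘ-/ i m) (toℚᵘ-/ j m) ⟩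
  mkℚᵘ i m ℚᵘ.+ mkℚᵘ j m                   ≃⟨ *≡* (trans (common-denominator i j M)
                                                  (cong ((i + j) *_) (sym (ℤ.pos-* (suc m) (suc m))))) ⟩
  mkℚᵘ (i + j) m                           ≃⟨ toℚᵘ-/ (i + j) m ⟨
  toℚᵘ ((i + j) / suc m)                   ∎)
  where
  open ℚᵘ.≤-Reasoning
  M = + suc m
  common-denominator : ∀ i j M → (i * M + j * M) * M ≡ (i + j) * (M * M)
  common-denominator = solve-∀

toℚᵘ-/-square : ∀ i m → toℚᵘ ((i / suc m) ℚ.* (i / suc m)) ≃ mkℚᵘ i m ℚᵘ.* mkℚᵘ i m
toℚᵘ-/-square i m =
  ℚᵘ.≃-trans (ℚ.toℚᵘ-homo-* (i / suc m) (i / suc m)) (ℚᵘ.*-cong (toℚᵘ-/ i m) (toℚᵘ-/ i m))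

/-square-≤-ι : ∀ i n m → i * i ≤ n * (+ suc m * + suc m) → (i / suc m) ℚ.* (i / suc m) ℚ.≤ ι n
/-square-≤-ι i n m i²≤nM² = ℚ.toℚᵘ-cancel-≤ (begin
  toℚᵘ ((i / suc m) ℚ.* (i / suc m))  ≃⟨ toℚᵘ-/-square i m ⟩
  mkℚᵘ i m ℚᵘ.* mkℚᵘ i m             ≤⟨ *≤* (subst₂ _≤_ (sym (ℤ.*-identityʳ (i * i)))
                                              (cong (n *_) (sym (ℤ.pos-* (suc m) (suc m)))) i²≤nM²) ⟩
  mkℚᵘ n 0                           ≃⟨ toℚᵘ-/ n 0 ⟨
  toℚᵘ (ι n)                         ∎)
  where open ℚᵘ.≤-Reasoning

ι-≤-/-square : ∀ i n m → n * (+ suc m * + suc m) ≤ i * i → ι n ℚ.≤ (i / suc m) ℚ.* (i / suc m)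
ι-≤-/-square i n m nM²≤i² = ℚ.toℚᵘ-cancel-≤ (begin
  toℚᵘ (ι n)                         ≃⟨ toℚᵘ-/ n 0 ⟩
  mkℚᵘ n 0                           ≤⟨ *≤* (subst₂ _≤_ (cong (n *_) (sym (ℤ.pos-* (suc m) (suc m))))
                                              (sym (ℤ.*-identityʳ (i * i))) nM²≤i²) ⟩
  mkℚᵘ i m ℚᵘ.* mkℚᵘ i m             ≃⟨ toℚᵘ-/-square i m ⟨
  toℚᵘ ((i / suc m) ℚ.* (i / suc m))  ∎)
  where open ℚᵘ.≤-Reasoning

archimedean : ∀ k {c} → 0ℚ ℚ.< c → Σ ℕ λ m → + k / suc m ℚ.< c
archimedean k {mkℚ (+ suc n) d-1 _} _ =
  m , ℚ.toℚᵘ-cancel-< (ℚᵘ.<-respˡ-≃ (ℚᵘ.≃-sym (toℚᵘ-/ (+ k) m)) (*<* kd<nm))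
  where
  m = k ℕ.* suc d-1
  kd<nm : + k * + suc d-1 ℤ.< + suc n * + suc m
  kd<nm = subst₂ ℤ._<_ (ℤ.pos-* k (suc d-1)) (ℤ.pos-* (suc n) (suc m)) (ℤ.+<+ (ℕ.m≤n*m (suc m) (suc n)))
archimedean k {mkℚ (+ zero) _ _} (ℚ.*<* (ℤ.+<+ ()))
archimedean k {mkℚ -[1+ n ] _ _} (ℚ.*<* ())

0<i/m+c : ∀ {i c} j m → - + suc j ≤ i → + suc j / suc m ℚ.< c → 0ℚ ℚ.< i / suc m ℚ.+ c
0<i/m+c {i} {c} j m -[j+1]≤i [j+1]/m<c = begin-strict
  0ℚ                                         ≡⟨ ℚ.+-inverseˡ (+ suc j / suc m) ⟨
  ℚ.- (+ suc j / suc m) ℚ.+ + suc j / suc m  <⟨ ℚ.+-mono-≤-< (/-mono-≤ m -[j+1]≤i) [j+1]/m<c ⟩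
  i / suc m ℚ.+ c                            ∎
  where open ℚ.≤-Reasoning

-- Rational certificates for A √a + B √b + c > 0

leSqrt-floor : ∀ {B b k} m → 0ℤ ≤ B → + k * + k ≤ B * B * + b * (+ suc m * + suc m) →
               LeSqrt (+ k / suc m) B b
leSqrt-floor {B} {b} {k} m 0≤B k²≤ = inj₁ (0≤B , inj₂ (/-square-≤-ι (+ k) (B * B * + b) m k²≤))

leSqrt-ceil : ∀ {A a k} m → A ≤ 0ℤ → A * A * + a * (+ suc m * + suc m) ≤ + suc k * + suc k →
              LeSqrt (-[1+ k ] / suc m) A a
leSqrt-ceil {+ zero}    {k = k} m _ _   = inj₁ (ℤ.≤-refl , inj₁ (/-nonPos { -[1+ k ]} m ℤ.-≤+))
leSqrt-ceil {+ suc n}           m (ℤ.+≤+ ()) _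
leSqrt-ceil { -[1+ n ]} {a} {k} m _ ≤k² =
  inj₂ (ℤ.-<+ , /-nonPos { -[1+ k ]} m ℤ.-≤+ , ι-≤-/-square -[1+ k ] (-[1+ n ] * -[1+ n ] * + a) m ≤k²)

posComb-nonNeg : ∀ {r s A B c} → 0ℤ ≤ A → 0ℤ ≤ B → 0ℚ ℚ.< c → PosComb r s A B c
posComb-nonNeg {c = c} 0≤A 0≤B 0<c =
  0ℚ , 0ℚ , inj₁ (0≤A , inj₁ ℚ.≤-refl) , inj₁ (0≤B , inj₁ ℚ.≤-refl) ,
  subst (0ℚ ℚ.<_) (sym (ℚ.+-identityˡ c)) 0<c

posComb-swap : ∀ {r s A B c} → PosComb r s A B c → PosComb s r B A c
posComb-swap {c = c} (p , q , p≤A√s , q≤B√r , 0<p+q+c) =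
  q , p , q≤B√r , p≤A√s , subst (λ u → 0ℚ ℚ.< u ℚ.+ c) (ℚ.+-comm p q) 0<p+q+c

floor-sqrts-close : ∀ {a b A B D kA kB} m j → 1 ℕ.≤ a → 1 ℕ.≤ b →
  A * A * + a ≤ B * B * + b + D → + suc m * + suc m * D ≤ + j * (+ suc m * (B - A) + 1ℤ) →
  + kA * + kA ≤ A * A * + a * (+ suc m * + suc m) →
  A * A * + a * (+ suc m * + suc m) ℤ.< + suc kA * + suc kA →
  B * B * + b * (+ suc m * + suc m) ℤ.< + suc kB * + suc kB →
  + kA ≤ + kB + + j
floor-sqrts-close {a} {b} {A} {B} {D} {kA} {kB} m j 1≤a 1≤b A²a≤B²b+D M²D≤j[M[B-A]+1]
                  kA²≤X X<[kA+1]² Y<[kB+1]² =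
  floor-sqrt-gap {kA = kA} {kB} {j} kA²≤X Y<[kB+1]² X≤Y+M²D M²D≤j[kA+kB+1]
  where
  M M² : ℤ
  M  = + suc m
  M² = M * M
  X≤Y+M²D : A * A * + a * M² ≤ B * B * + b * M² + M² * D
  X≤Y+M²D = subst (A * A * + a * M² ≤_) (scale-sum (B * B * + b) D M²)
    (ℤ.*-monoʳ-≤-nonNeg M² {{ℤ.nonNegative (square-nonNeg M)}} A²a≤B²b+D)
    where
    scale-sum : ∀ u v w → (u + v) * w ≡ u * w + w * v
    scale-sum = solve-∀
  M[-A]≤kA : M * (- A) ≤ + kA
  M[-A]≤kA = ≤-of-scaled-square-< 1≤a (subst (ℤ._< _) (sym (square-of-neg-scaled A (+ a) M)) X<[kA+1]²)
    where
    square-of-neg-scaled : ∀ u n w → w * (- u) * (w * (- u)) * n ≡ u * u * n * (w * w)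
    square-of-neg-scaled = solve-∀
  MB≤kB : M * B ≤ + kB
  MB≤kB = ≤-of-scaled-square-< 1≤b (subst (ℤ._< _) (sym (square-of-scaled B (+ b) M)) Y<[kB+1]²)
    where
    square-of-scaled : ∀ u n w → w * u * (w * u) * n ≡ u * u * n * (w * w)
    square-of-scaled = solve-∀
  M²D≤j[kA+kB+1] : M² * D ≤ + j * (+ kA + + kB + 1ℤ)
  M²D≤j[kA+kB+1] = ℤ.≤-trans M²D≤j[M[B-A]+1] (ℤ.*-monoˡ-≤-nonNeg (+ j) (ℤ.+-monoˡ-≤ 1ℤ
    (subst (_≤ + kA + + kB) (split-width A B M) (ℤ.+-mono-≤ M[-A]≤kA MB≤kB))))
    where
    split-width : ∀ u v w → w * (- u) + w * v ≡ w * (v - u)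
    split-width = solve-∀

-- The witnesses are -(⌊M |A| √a⌋ + 1) / M and ⌊M B √b⌋ / M, where M = m + 1.
posComb-of-square-bound : ∀ {a b A B D c} m j → 1 ℕ.≤ a → 1 ℕ.≤ b → A ≤ 0ℤ → 0ℤ ≤ B →
  A * A * + a ≤ B * B * + b + D →
  + suc m * + suc m * D ≤ + j * (+ suc m * (B - A) + 1ℤ) →
  + suc j / suc m ℚ.< c →
  PosComb b a A B c
posComb-of-square-bound {a} {b} {A} {B} {D} {c} m j 1≤a 1≤b A≤0 0≤B A²a≤B²b+D M²D≤j[M[B-A]+1] [j+1]/M<c
  with floor-sqrt (scaled-square-nonNeg A a (+ suc m)) | floor-sqrt (scaled-square-nonNeg B b (+ suc m))
... | kA , kA²≤X , X<[kA+1]² | kB , kB²≤Y , Y<[kB+1]² =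
  -[1+ kA ] / suc m , + kB / suc m ,
  leSqrt-ceil {k = kA} m A≤0 (ℤ.<⇒≤ X<[kA+1]²) ,
  leSqrt-floor {k = kB} m 0≤B kB²≤Y ,
  subst (λ p+q → 0ℚ ℚ.< p+q ℚ.+ c) (sym (/-+ -[1+ kA ] (+ kB) m)) (0<i/m+c j m -[j+1]≤p+q [j+1]/M<c)
  where
  kA≤kB+j : + kA ≤ + kB + + j
  kA≤kB+j = floor-sqrts-close {a} {b} {A} {B} {D} {kA} {kB} m j 1≤a 1≤b A²a≤B²b+D M²D≤j[M[B-A]+1]
                                kA²≤X X<[kA+1]² Y<[kB+1]²
  -[j+1]≤p+q : - + suc j ≤ -[1+ kA ] + + kB
  -[j+1]≤p+q = ≤-of-difference _ (rearrange (+ kA) (+ kB) (+ j)) (ℤ.i≤j⇒0≤j-i kA≤kB+j)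
    where
    rearrange : ∀ u v w → (- (1ℤ + u) + v) - (- (1ℤ + w)) ≡ (v + w) - u
    rearrange = solve-∀

posComb-of-bounded-defect : ∀ {a b A B K c} m → 1 ℕ.≤ a → 1 ℕ.≤ b → 0ℚ ℚ.< c → + 2 / suc m ℚ.< c →
  0ℤ ≤ B → A * A * + a ≤ B * B * + b + + K → + suc m * + K ≤ B - A → PosComb b a A B c
posComb-of-bounded-defect {A = A} {B} {K} m 1≤a 1≤b 0<c 2/M<c 0≤B A²a≤B²b+K MK≤B-A with 0ℤ ℤ.≤? A
... | yes 0≤A = posComb-nonNeg 0≤A 0≤B 0<c
... | no  0≰A = posComb-of-square-bound m 1 1≤a 1≤b (ℤ.<⇒≤ (ℤ.≰⇒> 0≰A)) 0≤B A²a≤B²b+K M²K≤M[B-A]+1 2/M<c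
  where
  M = + suc m
  M²K≤M[B-A]+1 : M * M * + K ≤ + 1 * (M * (B - A) + 1ℤ)
  M²K≤M[B-A]+1 = begin
    M * M * + K               ≡⟨ ℤ.*-assoc M M (+ K) ⟩
    M * (M * + K)             ≤⟨ ℤ.*-monoˡ-≤-nonNeg M MK≤B-A ⟩
    M * (B - A)               ≤⟨ ℤ.i≤i+j (M * (B - A)) 1ℤ ⟩
    M * (B - A) + 1ℤ          ≡⟨ ℤ.*-identityˡ (M * (B - A) + 1ℤ) ⟨
    + 1 * (M * (B - A) + 1ℤ)  ∎
    where open ℤ.≤-Reasoning

-- The dynamics of f_{r,s} on Rec

invariant : ℕ → ℕ → State → ℤ
invariant r s (x , y , z) = + r * y * (y - + s) - + s * x * (x + + r - + 2) + + 2 * + r * + s * z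

width : State → ℤ
width (x , y , z) = y - x

width-nonNeg : ∀ {σ} → InRec σ → 0ℤ ≤ width σ
width-nonNeg (x≤0 , 0≤y , _) = ℤ.i≤j⇒0≤j-i (ℤ.≤-trans x≤0 0≤y)

invariant-f : ∀ r s σ → invariant r s (f r s σ) ≡ invariant r s σ
invariant-f r s (x , y , z) with (x + y) ℤ.≤? z
... | yes _ = grow-right (+ r) (+ s) x y z
  where
  grow-right : ∀ R S x y z →
    R * (y + S) * (y + S - S) - S * x * (x + R - + 2) + + 2 * R * S * (z - y)
      ≡ R * y * (y - S) - S * x * (x + R - + 2) + + 2 * R * S * z
  grow-right = solve-∀
... | no  _ = grow-left (+ r) (+ s) x y z
  where
  grow-left : ∀ R S x y z →
    R * y * (y - S) - S * (x - R) * (x - R + R - + 2) + + 2 * R * S * (z - x + + 1)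
      ≡ R * y * (y - S) - S * x * (x + R - + 2) + + 2 * R * S * z
  grow-left = solve-∀

f-preserves-InRec : ∀ r s σ → InRec σ → InRec (f r s σ)
f-preserves-InRec r s (x , y , z) (x≤0 , 0≤y , x≤z , z≤y) with (x + y) ℤ.≤? z
... | yes x+y≤z =
  x≤0 ,
  ℤ.+-mono-≤ 0≤y (ℤ.+≤+ ℕ.z≤n) ,
  ≤-of-difference _ ([z-y]-x≡z-[x+y] x y z) (ℤ.i≤j⇒0≤j-i x+y≤z) ,
  ≤-of-difference _ ([y+s]-[z-y]≡[y-z]+y+s y z (+ s))
    (ℤ.+-mono-≤ (ℤ.+-mono-≤ (ℤ.i≤j⇒0≤j-i z≤y) 0≤y) (ℤ.+≤+ ℕ.z≤n))
  where
  [z-y]-x≡z-[x+y] : ∀ x y z → z - y - x ≡ z - (x + y)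
  [z-y]-x≡z-[x+y] = solve-∀
  [y+s]-[z-y]≡[y-z]+y+s : ∀ y z s → y + s - (z - y) ≡ y - z + y + s
  [y+s]-[z-y]≡[y-z]+y+s = solve-∀
... | no x+y≰z =
  ℤ.i≤j⇒i-k≤j (+ r) x≤0 ,
  0≤y ,
  ≤-of-difference _ ([z-x+1]-[x-r]≡[z-x]-x+[r+1] x z (+ r))
    (ℤ.+-mono-≤ (ℤ.+-mono-≤ (ℤ.i≤j⇒0≤j-i x≤z) (ℤ.neg-mono-≤ x≤0)) (ℤ.+≤+ ℕ.z≤n)) ,
  ≤-of-difference _ (y-[z-x+1]≡[x+y]-[1+z] x y z) (ℤ.i≤j⇒0≤j-i (ℤ.i<j⇒suc[i]≤j (ℤ.≰⇒> x+y≰z)))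
  where
  [z-x+1]-[x-r]≡[z-x]-x+[r+1] : ∀ x z r → z - x + + 1 - (x - r) ≡ z - x + (- x) + (r + + 1)
  [z-x+1]-[x-r]≡[z-x]-x+[r+1] = solve-∀
  y-[z-x+1]≡[x+y]-[1+z] : ∀ x y z → y - (z - x + + 1) ≡ x + y - (1ℤ + z)
  y-[z-x+1]≡[x+y]-[1+z] = solve-∀

width-f : ∀ {r s} → 1 ℕ.≤ r → 1 ℕ.≤ s → ∀ σ → width σ + 1ℤ ≤ width (f r s σ)
width-f {r} {s} 1≤r 1≤s (x , y , z) with (x + y) ℤ.≤? z
... | yes _ = ≤-of-difference _ (grow-right (+ s) x y) (ℤ.i≤j⇒0≤j-i (ℤ.+≤+ 1≤s))
  where
  grow-right : ∀ s x y → y + s - x - (y - x + 1ℤ) ≡ s - 1ℤ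
  grow-right = solve-∀
... | no  _ = ≤-of-difference _ (grow-left (+ r) x y) (ℤ.i≤j⇒0≤j-i (ℤ.+≤+ 1≤r))
  where
  grow-left : ∀ r x y → y - (x - r) - (y - x + 1ℤ) ≡ r - 1ℤ
  grow-left = solve-∀

iter-preserves : ∀ {g} (P : State → Set) → (∀ {σ} → P σ → P (g σ)) → ∀ t {σ} → P σ → P (iter g t σ)
iter-preserves P step zero    Pσ = Pσ
iter-preserves P step (suc t) Pσ = step (iter-preserves P step t Pσ)

iter-increasing : ∀ {g} (h : State → ℤ) → (∀ σ → h σ + 1ℤ ≤ h (g σ)) → ∀ t σ → h σ + + t ≤ h (iter g t σ)
iter-increasing h step zero    σ = ℤ.≤-reflexive (ℤ.+-identityʳ (h σ))
iter-increasing {g} h step (suc t) σ = begin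
  h σ + + suc t         ≡⟨ cong (_+_ (h σ)) (ℤ.+-comm 1ℤ (+ t)) ⟩
  h σ + (+ t + 1ℤ)      ≡⟨ ℤ.+-assoc (h σ) (+ t) 1ℤ ⟨
  h σ + + t + 1ℤ        ≤⟨ ℤ.+-monoˡ-≤ 1ℤ (iter-increasing h step t σ) ⟩
  h (iter g t σ) + 1ℤ   ≤⟨ step (iter g t σ) ⟩
  h (iter g (suc t) σ)  ∎
  where open ℤ.≤-Reasoning

bound-slack : ℕ → ℕ → ℤ → ℕ
bound-slack r s I = ∣ I ∣ ℕ.+ (r ℕ.* s ℕ.+ 2 ℕ.* s)

bound-constant : ℕ → ℕ → ℤ → ℚ
bound-constant r s I = + suc (suc (bound-slack r s I)) / 1

K+Lw≤[K+L][w+1] : ∀ K L {w} → 0ℤ ≤ w → + K + + L * w ≤ + (K ℕ.+ L) * (w + 1ℤ)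
K+Lw≤[K+L][w+1] K L {w} 0≤w = ≤-of-difference _ (identity (+ K) (+ L) w)
  (ℤ.+-mono-≤ (*-nonNeg {+ K} (ℤ.+≤+ ℕ.z≤n) 0≤w) (ℤ.+≤+ ℕ.z≤n))
  where
  identity : ∀ K L w → (K + L) * (w + 1ℤ) - (K + L * w) ≡ K * w + L
  identity = solve-∀

sx²≤ry²+slack : ∀ {r s x y z} → InRec (x , y , z) →
  x * x * + s ≤ y * y * + r + (+ ∣ invariant r s (x , y , z) ∣ + (+ r * + s + + 2 * + s) * (y - x))
sx²≤ry²+slack {r} {s} {x} {y} {z} (x≤0 , 0≤y , x≤z , z≤y) = ≤-of-difference _
  (identity (+ r) (+ s) x y z (+ ∣ invariant r s (x , y , z) ∣))
  (ℤ.+-mono-≤ (ℤ.+-mono-≤ (ℤ.+-mono-≤ (0≤∣i∣+i (invariant r s (x , y , z)))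
    (nonNeg-multiple 2 (nonNeg-multiple r (nonNeg-multiple s (ℤ.i≤j⇒0≤j-i z≤y)))))
    (nonNeg-multiple 2 (nonNeg-multiple s 0≤y)))
    (nonNeg-multiple 4 (nonNeg-multiple s (ℤ.neg-mono-≤ x≤0))))
  where
  identity : ∀ R S x y z K →
    y * y * R + (K + (R * S + + 2 * S) * (y - x)) - x * x * S
      ≡ K + (R * y * (y - S) - S * x * (x + R - + 2) + + 2 * R * S * z)
        + + 2 * (R * (S * (y - z))) + + 2 * (S * y) + + 4 * (S * (- x))
  identity = solve-∀

ry²≤sx²+slack : ∀ {r s x y z} → InRec (x , y , z) →
  - y * - y * + r ≤ - x * - x * + s + (+ ∣ invariant r s (x , y , z) ∣ + (+ r * + s + + 2 * + s) * (y - x))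
ry²≤sx²+slack {r} {s} {x} {y} {z} (x≤0 , 0≤y , x≤z , z≤y) = ≤-of-difference _
  (identity (+ r) (+ s) x y z (+ ∣ invariant r s (x , y , z) ∣))
  (ℤ.+-mono-≤ (ℤ.+-mono-≤ (0≤∣i∣-i (invariant r s (x , y , z)))
    (nonNeg-multiple 2 (nonNeg-multiple r (nonNeg-multiple s (ℤ.i≤j⇒0≤j-i x≤z)))))
    (nonNeg-multiple 2 (nonNeg-multiple s 0≤y)))
  where
  identity : ∀ R S x y z K →
    - x * - x * S + (K + (R * S + + 2 * S) * (y - x)) - - y * - y * R
      ≡ K - (R * y * (y - S) - S * x * (x + R - + 2) + + 2 * R * S * z)
        + + 2 * (R * (S * (z - x))) + + 2 * (S * y)
  identity = solve-∀

bounded-by-invariant : ∀ {r s x y z I} → 1 ℕ.≤ r → 1 ℕ.≤ s → InRec (x , y , z) → invariant r s (x , y , z) ≡ I →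
  PosComb r s (- x) (- y) (bound-constant r s I) × PosComb r s x y (bound-constant r s I)
bounded-by-invariant {r} {s} {x} {y} {z} 1≤r 1≤s σ∈Rec@(x≤0 , 0≤y , _) refl =
  posComb-swap (posComb-of-square-bound 0 j 1≤r 1≤s (ℤ.neg-mono-≤ 0≤y) (ℤ.neg-mono-≤ x≤0) (ry²≤sx²+slack σ∈Rec)
    (subst (λ w → + 1 * + 1 * D ≤ + j * (+ 1 * w + 1ℤ)) (sym (flip-width x y)) D-small) C-large) ,
  posComb-of-square-bound 0 j 1≤s 1≤r x≤0 0≤y (sx²≤ry²+slack σ∈Rec) D-small C-large
  where
  I = invariant r s (x , y , z)
  L = r ℕ.* s ℕ.+ 2 ℕ.* s
  j = bound-slack r s I
  D = + ∣ I ∣ + (+ r * + s + + 2 * + s) * (y - x)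
  D-small : + 1 * + 1 * D ≤ + j * (+ 1 * (y - x) + 1ℤ)
  D-small = begin
    + 1 * D                                      ≡⟨ ℤ.*-identityˡ D ⟩
    + ∣ I ∣ + (+ r * + s + + 2 * + s) * (y - x)  ≡⟨ cong (λ ℓ → + ∣ I ∣ + ℓ * (y - x)) L≡ ⟨
    + ∣ I ∣ + + L * (y - x)                      ≤⟨ K+Lw≤[K+L][w+1] ∣ I ∣ L (width-nonNeg σ∈Rec) ⟩
    + j * (y - x + 1ℤ)                           ≡⟨ cong (λ w → + j * (w + 1ℤ)) (ℤ.*-identityˡ (y - x)) ⟨
    + j * (+ 1 * (y - x) + 1ℤ)                   ∎
    where
    open ℤ.≤-Reasoning
    L≡ : + L ≡ + r * + s + + 2 * + s
    L≡ = cong₂ _+_ (ℤ.pos-* r s) (ℤ.pos-* 2 s)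
  C-large : + suc j / 1 ℚ.< bound-constant r s I
  C-large = /-mono-< {+ suc j} 0 (ℤ.+<+ ℕ.≤-refl)
  flip-width : ∀ x y → - x - - y ≡ y - x
  flip-width = solve-∀

-- 4 I + r s² - s (r-2)² = r (2y-s)² - s (2x+r-2)² + 8 r s z.
defect : ℕ → ℕ → ℤ → ℕ
defect r s I = ∣ + 4 * I + + r * + s * + s - + s * (+ r - + 2) * (+ r - + 2) ∣

s[2x+r-2]²≤r[2y+s]²+defect : ∀ {r s x y z} → z ≤ y →
  (+ 2 * x + + r - + 2) * (+ 2 * x + + r - + 2) * + s
    ≤ (+ 2 * y + + s) * (+ 2 * y + + s) * + r + + defect r s (invariant r s (x , y , z))
s[2x+r-2]²≤r[2y+s]²+defect {r} {s} {x} {y} {z} z≤y = ≤-of-difference _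
  (identity (+ r) (+ s) x y z (+ defect r s (invariant r s (x , y , z))))
  (ℤ.+-mono-≤ (0≤∣i∣+i κ) (nonNeg-multiple 8 (nonNeg-multiple r (nonNeg-multiple s (ℤ.i≤j⇒0≤j-i z≤y)))))
  where
  κ = + 4 * invariant r s (x , y , z) + + r * + s * + s - + s * (+ r - + 2) * (+ r - + 2)
  identity : ∀ R S x y z K →
    (+ 2 * y + S) * (+ 2 * y + S) * R + K - (+ 2 * x + R - + 2) * (+ 2 * x + R - + 2) * S
      ≡ K + (+ 4 * (R * y * (y - S) - S * x * (x + R - + 2) + + 2 * R * S * z) + R * S * S - S * (R - + 2) * (R - + 2))
        + + 8 * (R * (S * (y - z)))
  identity = solve-∀

r[s-2y]²≤s[r+2-2x]²+defect : ∀ {r s x y z} → x ≤ z →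
  (+ s - + 2 * y) * (+ s - + 2 * y) * + r
    ≤ (+ r + + 2 - + 2 * x) * (+ r + + 2 - + 2 * x) * + s + + defect r s (invariant r s (x , y , z))
r[s-2y]²≤s[r+2-2x]²+defect {r} {s} {x} {y} {z} x≤z = ≤-of-difference _
  (identity (+ r) (+ s) x y z (+ defect r s (invariant r s (x , y , z))))
  (ℤ.+-mono-≤ (ℤ.+-mono-≤ (0≤∣i∣-i κ) (nonNeg-multiple 8 (nonNeg-multiple r {+ s} (ℤ.+≤+ ℕ.z≤n))))
    (nonNeg-multiple 8 (nonNeg-multiple r (nonNeg-multiple s (ℤ.i≤j⇒0≤j-i x≤z)))))
  where
  κ = + 4 * invariant r s (x , y , z) + + r * + s * + s - + s * (+ r - + 2) * (+ r - + 2)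
  identity : ∀ R S x y z K →
    (R + + 2 - + 2 * x) * (R + + 2 - + 2 * x) * S + K - (S - + 2 * y) * (S - + 2 * y) * R
      ≡ K - (+ 4 * (R * y * (y - S) - S * x * (x + R - + 2) + + 2 * R * S * z) + R * S * S - S * (R - + 2) * (R - + 2))
        + + 8 * (R * S) + + 8 * (R * (S * (z - x)))
  identity = solve-∀

eventually-bounded : ∀ {r s x y z I m ε} → 1 ℕ.≤ r → 1 ℕ.≤ s → 0ℚ ℚ.< ε → + 2 / suc m ℚ.< ε →
  InRec (x , y , z) → invariant r s (x , y , z) ≡ I → + (suc m ℕ.* defect r s I ℕ.+ r ℕ.+ s) ≤ y - x →
  PosComb r s ((+ 2 ℤ.* x ℤ.+ + r) - + 2) (+ 2 ℤ.* y ℤ.+ + s) ε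
  × PosComb r s ((+ r ℤ.+ + 2) - + 2 ℤ.* x) (+ s - + 2 ℤ.* y) ε
eventually-bounded {r} {s} {x} {y} {z} {m = m} 1≤r 1≤s 0<ε 2/M<ε σ∈Rec@(x≤0 , 0≤y , x≤z , z≤y) refl N≤y-x =
  posComb-of-bounded-defect m 1≤s 1≤r 0<ε 2/M<ε 0≤2y+s (s[2x+r-2]²≤r[2y+s]²+defect z≤y) lower-width ,
  posComb-swap (posComb-of-bounded-defect m 1≤r 1≤s 0<ε 2/M<ε 0≤r+2-2x (r[s-2y]²≤s[r+2-2x]²+defect x≤z) upper-width)
  where
  K = defect r s (invariant r s (x , y , z))
  M = + suc m
  0≤2y+s : 0ℤ ≤ + 2 * y + + s
  0≤2y+s = ℤ.+-mono-≤ (nonNeg-multiple 2 0≤y) (ℤ.+≤+ ℕ.z≤n)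
  0≤r+2-2x : 0ℤ ≤ + r + + 2 - + 2 * x
  0≤r+2-2x = ≤-of-difference _ (identity x (+ r)) (ℤ.+-mono-≤ (ℤ.+≤+ ℕ.z≤n) (nonNeg-multiple 2 (ℤ.neg-mono-≤ x≤0)))
    where
    identity : ∀ x r → r + + 2 - + 2 * x - 0ℤ ≡ r + + 2 + + 2 * (- x)
    identity = solve-∀
  0≤y-x-N : 0ℤ ≤ y - x - (M * + K + + r + + s)
  0≤y-x-N = ℤ.i≤j⇒0≤j-i (subst (_≤ y - x) (cong (λ u → u + + r + + s) (ℤ.pos-* (suc m) K)) N≤y-x)
  lower-width : M * + K ≤ + 2 * y + + s - (+ 2 * x + + r - + 2)
  lower-width = ≤-of-difference _ (identity (+ r) (+ s) x y (M * + K))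
    (ℤ.+-mono-≤ (ℤ.+-mono-≤ 0≤y-x-N (width-nonNeg σ∈Rec)) (ℤ.+≤+ ℕ.z≤n))
    where
    identity : ∀ R S x y N → + 2 * y + S - (+ 2 * x + R - + 2) - N ≡ y - x - (N + R + S) + (y - x) + (S + S + + 2)
    identity = solve-∀
  upper-width : M * + K ≤ + r + + 2 - + 2 * x - (+ s - + 2 * y)
  upper-width = ≤-of-difference _ (identity (+ r) (+ s) x y (M * + K))
    (ℤ.+-mono-≤ (ℤ.+-mono-≤ 0≤y-x-N (width-nonNeg σ∈Rec)) (ℤ.+≤+ ℕ.z≤n))
    where
    identity : ∀ R S x y N → R + + 2 - + 2 * x - (S - + 2 * y) - N ≡ y - x - (N + R + S) + (y - x) + (R + R + + 2)
    identity = solve-∀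

theorem3p1 : (r s : ℕ) → 0 < r → 0 < s → (σ₀ : State) → InRec σ₀ →
    (Σ ℚ λ C → (t : ℕ) → let (x , y , z) = iter (f r s) t σ₀ in
        PosComb r s (- x) (- y) C × PosComb r s x y C)
    ×
    ((ε : ℚ) → 0ℚ ℚ.< ε → Σ ℕ λ N → (t : ℕ) → N < t →
      let (x , y , z) = iter (f r s) t σ₀ in
        PosComb r s ((+ 2 ℤ.* x ℤ.+ + r) - + 2) (+ 2 ℤ.* y ℤ.+ + s) ε
      × PosComb r s ((+ r ℤ.+ + 2) - + 2 ℤ.* x) (+ s - + 2 ℤ.* y) ε)
theorem3p1 r s 1≤r 1≤s σ₀ σ₀∈Rec =
    (bound-constant r s I₀ , λ t → bounded-by-invariant 1≤r 1≤s (σₜ∈Rec t) (Iσₜ≡I₀ t))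
  , λ ε 0<ε → let (m , 2/M<ε) = archimedean 2 0<ε in
      suc m ℕ.* defect r s I₀ ℕ.+ r ℕ.+ s ,
      λ t N<t → eventually-bounded {m = m} 1≤r 1≤s 0<ε 2/M<ε (σₜ∈Rec t) (Iσₜ≡I₀ t)
                  (ℤ.≤-trans (ℤ.+≤+ (ℕ.<⇒≤ N<t)) (t≤width t))
  where
  I₀ = invariant r s σ₀
  σₜ∈Rec : ∀ t → InRec (iter (f r s) t σ₀)
  σₜ∈Rec t = iter-preserves InRec (f-preserves-InRec r s _) t σ₀∈Rec
  Iσₜ≡I₀ : ∀ t → invariant r s (iter (f r s) t σ₀) ≡ I₀
  Iσₜ≡I₀ t = iter-preserves (λ σ → invariant r s σ ≡ I₀) (trans (invariant-f r s _)) t refl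
  t≤width : ∀ t → + t ≤ width (iter (f r s) t σ₀)
  t≤width t = ℤ.≤-trans (ℤ.+-monoˡ-≤ (+ t) (width-nonNeg σ₀∈Rec)) (iter-increasing width (width-f 1≤r 1≤s) t σ₀)
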